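{- Let $V$ be an optimal computer. Then for every computer $C$ there exists $d\in\mathbb{N}$ such that, for every $p\in\{0,1\}^*$, the question whether $p\in\mathrm{Dom}\,C$ can be decided effectively (uniformly in $p$) from $p$ together with the list of all strings $q\in\mathrm{Dom}\,V$ with $|q|\le|p|+d$.
   Context: $\{0,1\}^*$ is the set of finite binary strings. A computer is a partial recursive function $C\colon\{0,1\}^*\to\{0,1\}^*$ whose domain $\mathrm{Dom}\,C$ is prefix-free. A computer $U$ is optimal if for every computer $C$ there is $d\in\mathbb{N}$ such that for every $p\in\mathrm{Dom}\,C$ there is $q$ with $U(q)=C(p)$ and $|q|\le|p|+d$. "Can be decided effectively" means there is an algorithm that, given $p$ and this finite list, correctly outputs whether $p\in\mathrm{Dom}\,C$. -}

module Defs where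

open import Data.Nat using (ℕ; zero; suc; _+_; _*_; _≤_; _<_)
open import Data.Fin using (Fin)
open import Data.Bool using (Bool; true; false)
open import Data.List using (List; []; _∷_; _++_; length)
open import Data.Vec using (Vec; []; _∷_; lookup)
open import Data.Product using (Σ; ∃; _×_; _,_)
open import Relation.Binary.PropositionalEquality using (_≡_)

data Code : ℕ → Set where
  zer  : ∀ {n} → Code n
  succ : Code 1
  proj : ∀ {n} → Fin n → Code n
  comp : ∀ {m n} → Code m → Vec (Code n) m → Code n
  prec : ∀ {n} → Code n → Code (suc (suc n)) → Code (suc n)
  mu   : ∀ {n} → Code (suc n) → Code n

mutual
  data Eval : ∀ {n} → Code n → Vec ℕ n → ℕ → Set where
    ev-zer  : ∀ {n} {xs : Vec ℕ n} → Eval zer xs 0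
    ev-succ : ∀ {x} → Eval succ (x ∷ []) (suc x)
    ev-proj : ∀ {n} {i : Fin n} {xs} → Eval (proj i) xs (lookup xs i)
    ev-comp : ∀ {m n} {f : Code m} {gs : Vec (Code n) m} {xs ys v} →
              EvalAll gs xs ys → Eval f ys v → Eval (comp f gs) xs v
    ev-prec0 : ∀ {n} {f : Code n} {g} {xs v} →
              Eval f xs v → Eval (prec f g) (0 ∷ xs) v
    ev-precS : ∀ {n} {f : Code n} {g} {k xs u v} →
              Eval (prec f g) (k ∷ xs) u → Eval g (k ∷ u ∷ xs) v →
              Eval (prec f g) (suc k ∷ xs) v
    ev-mu   : ∀ {n} {f : Code (suc n)} {xs k} →
              Eval f (k ∷ xs) 0 →
              (∀ i → i < k → ∃ λ u → Eval f (i ∷ xs) (suc u)) →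
              Eval (mu f) xs k

  data EvalAll : ∀ {m n} → Vec (Code n) m → Vec ℕ n → Vec ℕ m → Set where
    ea-[] : ∀ {n} {xs : Vec ℕ n} → EvalAll [] xs []
    ea-∷  : ∀ {m n} {g : Code n} {gs : Vec (Code n) m} {xs y ys} →
            Eval g xs y → EvalAll gs xs ys → EvalAll (g ∷ gs) xs (y ∷ ys)

-- Binary strings {0,1}* = List Bool, coded bijectively as natural numbers
-- (bijective base-2 numeration).

enc : List Bool → ℕ
enc []          = 0
enc (false ∷ s) = suc (2 * enc s)
enc (true ∷ s)  = suc (suc (2 * enc s))

tri : ℕ → ℕ
tri zero    = zero
tri (suc n) = suc n + tri n

pair : ℕ → ℕ → ℕ
pair a b = tri (a + b) + b

encList : List (List Bool) → ℕ
encList []       = 0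
encList (x ∷ xs) = suc (pair (enc x) (encList xs))

-- Partial functions {0,1}* → {0,1}* given by codes of arity 1.
-- (Outputs are compared via their codes; enc is a bijection.)

Dom : Code 1 → List Bool → Set
Dom c p = ∃ λ v → Eval c (enc p ∷ []) v

_IsPrefixOf_ : List Bool → List Bool → Set
p IsPrefixOf q = ∃ λ r → p ++ r ≡ q

PrefixFree : (List Bool → Set) → Set
PrefixFree D = ∀ p q → D p → D q → p IsPrefixOf q → p ≡ q

IsComputer : Code 1 → Set
IsComputer c = PrefixFree (Dom c)

IsOptimal : Code 1 → Set
IsOptimal U = IsComputer U ×
  (∀ (C : Code 1) → IsComputer C →
     ∃ λ (d : ℕ) → ∀ (p : List Bool) (v : ℕ) → Eval C (enc p ∷ []) v →
       ∃ λ (q : List Bool) → Eval U (enc q ∷ []) v × length q ≤ length p + d)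

module Submission where

-- Let C' map p to the least fuel s with which a clocked interpreter
-- sees C halt on p.  C' has the same domain as C, so it is a computer, and
-- optimality of V gives d such that for every p ∈ Dom C some q ∈ L satisfies
-- V(q) = C'(p).  Given p and L, the decider first searches for a fuel k with
-- which V has halted on every member of L (it exists because L ⊆ Dom V), and
-- then tests, for each q ∈ L, whether C halts on p within fuel V(q).  Some
-- test succeeds iff p ∈ Dom C.

open import Defs
open import Data.Nat using (ℕ; zero; suc; _+_; _∸_; _≤_; _<_; pred; _⊔_; z≤n; s≤s)
open import Data.Nat.Properties
open import Data.Fin using (Fin; zero; suc; _↑ʳ_)
open import Data.Vec using (Vec; []; _∷_; lookup; tabulate; map; head; tail)
open import Data.Vec.Properties using (tabulate∘lookup; tabulate-cong)
open import Data.List using (List; []; _∷_; length)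
open import Data.List.Membership.Propositional using (_∈_)
open import Data.List.Relation.Unary.Any using (here; there)
open import Data.List.Relation.Unary.Unique.Propositional using (Unique)
open import Data.Bool using (Bool)
open import Data.Product using (∃; _×_; _,_; proj₁; proj₂)
open import Data.Sum using (inj₁; inj₂)
open import Data.Empty using (⊥-elim)
open import Relation.Binary using (tri<; tri≈; tri>)
open import Relation.Binary.PropositionalEquality
open import Relation.Nullary using (¬_)
open import Function.Bundles using (_⇔_; Equivalence)

Computes : ∀ {n} → Code n → (Vec ℕ n → ℕ) → Set
Computes c f = ∀ xs → Eval c xs (f xs)

ComputesAll : ∀ {n m} → Vec (Code n) m → (Vec ℕ n → Vec ℕ m) → Set
ComputesAll gs f = ∀ xs → EvalAll gs xs (f xs)

computes-cong : ∀ {n} {c : Code n} {f g} → Computes c f → (∀ xs → f xs ≡ g xs) → Computes c g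
computes-cong h e xs = subst (Eval _ xs) (e xs) (h xs)

computesAll-cong : ∀ {n m} {c : Vec (Code n) m} {f g} →
  ComputesAll c f → (∀ xs → f xs ≡ g xs) → ComputesAll c g
computesAll-cong h e xs = subst (EvalAll _ xs) (e xs) (h xs)

fun₁ : (ℕ → ℕ) → Vec ℕ 1 → ℕ
fun₁ f (x ∷ []) = f x

fun₂ : (ℕ → ℕ → ℕ) → Vec ℕ 2 → ℕ
fun₂ f (x ∷ y ∷ []) = f x y

fun₃ : (ℕ → ℕ → ℕ → ℕ) → Vec ℕ 3 → ℕ
fun₃ f (x ∷ y ∷ z ∷ []) = f x y z

c-zer : ∀ {n} → Computes (zer {n}) (λ _ → 0)
c-zer xs = ev-zer

c-proj : ∀ {n} (i : Fin n) → Computes (proj i) (λ xs → lookup xs i)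
c-proj i xs = ev-proj

c-succ : Computes succ (fun₁ suc)
c-succ (x ∷ []) = ev-succ

c-comp : ∀ {m n} {f : Code m} {gs : Vec (Code n) m} {F G} →
  Computes f F → ComputesAll gs G → Computes (comp f gs) (λ xs → F (G xs))
c-comp hf hg xs = ev-comp (hg xs) (hf _)

ca-[] : ∀ {n} → ComputesAll {n} [] (λ _ → [])
ca-[] xs = ea-[]

ca-∷ : ∀ {n m} {g : Code n} {gs : Vec (Code n) m} {f G} →
  Computes g f → ComputesAll gs G → ComputesAll (g ∷ gs) (λ xs → f xs ∷ G xs)
ca-∷ hg hgs xs = ea-∷ (hg xs) (hgs xs)

primrec : ∀ {n} → (Vec ℕ n → ℕ) → (Vec ℕ (suc (suc n)) → ℕ) → Vec ℕ (suc n) → ℕ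
primrec F G (zero ∷ xs) = F xs
primrec F G (suc k ∷ xs) = G (k ∷ primrec F G (k ∷ xs) ∷ xs)

c-prec : ∀ {n} {f : Code n} {g} {F G} → Computes f F → Computes g G →
  Computes (prec f g) (primrec F G)
c-prec hf hg (zero ∷ xs) = ev-prec0 (hf xs)
c-prec hf hg (suc k ∷ xs) = ev-precS (c-prec hf hg (k ∷ xs)) (hg _)

app₁ : ∀ {n} → Code 1 → Code n → Code n
app₁ f a = comp f (a ∷ [])

app₂ : ∀ {n} → Code 2 → Code n → Code n → Code n
app₂ f a b = comp f (a ∷ b ∷ [])

app₃ : ∀ {n} → Code 3 → Code n → Code n → Code n → Code n
app₃ f a b c = comp f (a ∷ b ∷ c ∷ [])

c-app₁ : ∀ {n} {f a F A} → Computes f (fun₁ F) → Computes {n} a A →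
  Computes (app₁ f a) (λ xs → F (A xs))
c-app₁ hf ha = c-comp hf (ca-∷ ha ca-[])

c-app₂ : ∀ {n} {f a b F A B} → Computes f (fun₂ F) → Computes {n} a A → Computes b B →
  Computes (app₂ f a b) (λ xs → F (A xs) (B xs))
c-app₂ hf ha hb = c-comp hf (ca-∷ ha (ca-∷ hb ca-[]))

c-app₃ : ∀ {n} {f a b c F A B C} → Computes f (fun₃ F) → Computes {n} a A →
  Computes b B → Computes c C → Computes (app₃ f a b c) (λ xs → F (A xs) (B xs) (C xs))
c-app₃ hf ha hb hc = c-comp hf (ca-∷ ha (ca-∷ hb (ca-∷ hc ca-[])))

-- Dropping the first k arguments, needed to pass the "remaining" arguments
-- of a code of variable arity along unchanged.
dropV : ∀ k {n} → Vec ℕ (k + n) → Vec ℕ n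
dropV zero xs = xs
dropV (suc k) (x ∷ xs) = dropV k xs

drops : ∀ k n → Vec (Code (k + n)) n
drops k n = tabulate (λ i → proj (k ↑ʳ i))

lookup-↑ʳ : ∀ k {n} (xs : Vec ℕ (k + n)) i → lookup xs (k ↑ʳ i) ≡ lookup (dropV k xs) i
lookup-↑ʳ zero xs i = refl
lookup-↑ʳ (suc k) (x ∷ xs) i = lookup-↑ʳ k xs i

ca-projs : ∀ {n m} (ρ : Fin m → Fin n) →
  ComputesAll (tabulate (λ i → proj (ρ i))) (λ xs → tabulate (λ i → lookup xs (ρ i)))
ca-projs {m = zero} ρ xs = ea-[]
ca-projs {m = suc m} ρ xs = ea-∷ ev-proj (ca-projs (λ i → ρ (suc i)) xs)

ca-drops : ∀ k n → ComputesAll (drops k n) (dropV k)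
ca-drops k n = computesAll-cong (ca-projs (k ↑ʳ_)) λ xs →
  trans (tabulate-cong (lookup-↑ʳ k xs)) (tabulate∘lookup (dropV k xs))

ONE : ∀ {n} → Code n
ONE = app₁ succ zer

c-ONE : ∀ {n} → Computes (ONE {n}) (λ _ → 1)
c-ONE = c-app₁ c-succ c-zer

PRED : Code 1
PRED = prec zer (proj zero)

c-PRED : Computes PRED (fun₁ pred)
c-PRED = computes-cong (c-prec c-zer (c-proj zero))
  λ { (zero ∷ []) → refl ; (suc k ∷ []) → refl }

ADD : Code 2
ADD = prec (proj zero) (app₁ succ (proj (suc zero)))

c-ADD : Computes ADD (fun₂ _+_)
c-ADD = computes-cong (c-prec (c-proj zero) (c-app₁ c-succ (c-proj (suc zero)))) add
  where
  add : ∀ xs → primrec _ _ xs ≡ fun₂ _+_ xs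
  add (zero ∷ y ∷ []) = refl
  add (suc x ∷ y ∷ []) = cong suc (add (x ∷ y ∷ []))

-- Truncated subtraction with swapped arguments, recursing on the subtrahend.
MONUS : Code 2
MONUS = prec (proj zero) (app₁ PRED (proj (suc zero)))

c-MONUS : Computes MONUS (fun₂ (λ y x → x ∸ y))
c-MONUS = computes-cong (c-prec (c-proj zero) (c-app₁ c-PRED (c-proj (suc zero)))) monus
  where
  monus : ∀ xs → primrec _ _ xs ≡ fun₂ (λ y x → x ∸ y) xs
  monus (zero ∷ x ∷ []) = refl
  monus (suc y ∷ x ∷ []) = trans (cong pred (monus (y ∷ x ∷ []))) (pred[m∸n]≡m∸[1+n] x y)

SUB : Code 2
SUB = app₂ MONUS (proj (suc zero)) (proj zero)

c-SUB : Computes SUB (fun₂ _∸_)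
c-SUB = computes-cong (c-app₂ c-MONUS (c-proj (suc zero)) (c-proj zero)) λ { (x ∷ y ∷ []) → refl }

ifz : ℕ → ℕ → ℕ → ℕ
ifz zero b c = b
ifz (suc _) b c = c

IFZ : Code 3
IFZ = prec (proj zero) (proj (suc (suc (suc zero))))

c-IFZ : Computes IFZ (fun₃ ifz)
c-IFZ = computes-cong (c-prec (c-proj zero) (c-proj (suc (suc (suc zero)))))
  λ { (zero ∷ b ∷ c ∷ []) → refl ; (suc a ∷ b ∷ c ∷ []) → refl }

TRI : Code 1
TRI = prec zer (app₂ ADD (app₁ succ (proj zero)) (proj (suc zero)))

c-TRI : Computes TRI (fun₁ tri)
c-TRI = computes-cong (c-prec c-zer (c-app₂ c-ADD (c-app₁ c-succ (c-proj zero)) (c-proj (suc zero)))) triangle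
  where
  triangle : ∀ xs → primrec _ _ xs ≡ fun₁ tri xs
  triangle (zero ∷ []) = refl
  triangle (suc x ∷ []) = cong (suc x +_) (triangle (x ∷ []))

-- The clocked interpreter.  `run c t xs` is 0 when no value has been found
-- with fuel t and `suc v` when the value v has been found; the fuel bounds
-- each unbounded search by t candidates.
guard : ℕ → ℕ → ℕ
guard a r = ifz a 0 r

guardAll : ∀ {m} → Vec ℕ m → ℕ → ℕ
guardAll [] r = r
guardAll (y ∷ ys) r = guard y (guardAll ys r)

precS : ℕ → (ℕ → ℕ → ℕ) → ℕ → ℕ
precS b s zero = b
precS b s (suc k) = guard (precS b s k) (s k (pred (precS b s k)))

-- One step of a clocked search for a root.  States: 0 = still searching,
-- 1 = stuck on a candidate without value, suc (suc k) = root k found.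
-- The candidate i has answer r.
muStep : ℕ → ℕ → ℕ → ℕ
muStep i s r = ifz s (ifz r 1 (ifz (pred r) (suc (suc i)) 0)) s

muS : (ℕ → ℕ) → ℕ → ℕ
muS r zero = 0
muS r (suc i) = muStep i (muS r i) (r i)

fin : ℕ → ℕ
fin s = ifz s 0 (ifz (pred s) 0 (pred s))

mutual
  run : ∀ {n} → Code n → ℕ → Vec ℕ n → ℕ
  run zer t xs = 1
  run succ t xs = suc (suc (head xs))
  run (proj i) t xs = suc (lookup xs i)
  run (comp f gs) t xs = guardAll (runAll gs t xs) (run f t (map pred (runAll gs t xs)))
  run (prec f g) t (k ∷ xs) = precS (run f t xs) (λ j a → run g t (j ∷ a ∷ xs)) k
  run (mu f) t xs = fin (muS (λ i → run f t (i ∷ xs)) t)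

  runAll : ∀ {n m} → Vec (Code n) m → ℕ → Vec ℕ n → Vec ℕ m
  runAll [] t xs = []
  runAll (g ∷ gs) t xs = run g t xs ∷ runAll gs t xs

guardAll-inv : ∀ {m} (ys : Vec ℕ m) r v → guardAll ys r ≡ suc v →
  ∃ λ zs → ys ≡ map suc zs × r ≡ suc v
guardAll-inv [] r v e = [] , refl , e
guardAll-inv (zero ∷ ys) r v ()
guardAll-inv (suc y ∷ ys) r v e with guardAll-inv ys r v e
... | zs , refl , e' = (y ∷ zs) , refl , e'

guardAll-values : ∀ {m} (zs : Vec ℕ m) r → guardAll (map suc zs) r ≡ r
guardAll-values [] r = refl
guardAll-values (z ∷ zs) r = guardAll-values zs r

pred-values : ∀ {m} (zs : Vec ℕ m) → map pred (map suc zs) ≡ zs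
pred-values [] = refl
pred-values (z ∷ zs) = cong (z ∷_) (pred-values zs)

fin-inv : ∀ s v → fin s ≡ suc v → s ≡ suc (suc v)
fin-inv (suc (suc s)) v refl = refl

muS-searching : ∀ r n → muS r n ≡ 0 → ∀ i → i < n → ∃ λ u → r i ≡ suc (suc u)
muS-searching r (suc n) e i i<n with muS r n in eq
... | suc s = ⊥-elim (1+n≢0 e)
... | zero with r n in eq2
...   | zero = ⊥-elim (1+n≢0 e)
...   | suc zero = ⊥-elim (1+n≢0 e)
...   | suc (suc u) with m≤n⇒m<n∨m≡n (≤-pred i<n)
...     | inj₁ lt = muS-searching r n eq i lt
...     | inj₂ refl = u , eq2

muS-found : ∀ r n k → muS r n ≡ suc (suc k) →
  r k ≡ 1 × (∀ i → i < k → ∃ λ u → r i ≡ suc (suc u))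
muS-found r (suc n) k e with muS r n in eq
... | suc s = muS-found r n k (trans eq e)
... | zero with r n in eq2
...   | zero = ⊥-elim (0≢1+n (suc-injective e))
...   | suc (suc u) = ⊥-elim (0≢1+n e)
...   | suc zero with e
...     | refl = eq2 , muS-searching r n eq

muS-before : ∀ r k → (∀ i → i < k → ∃ λ u → r i ≡ suc (suc u)) → ∀ n → n ≤ k → muS r n ≡ 0
muS-before r k h zero _ = refl
muS-before r k h (suc n) le rewrite muS-before r k h n (≤-trans (n≤1+n n) le) with h n le
... | u , e rewrite e = refl

muS-after : ∀ r k → (∀ i → i < k → ∃ λ u → r i ≡ suc (suc u)) → r k ≡ 1 →
  ∀ t → suc k ≤ t → muS r t ≡ suc (suc k)
muS-after r k h e t le = subst (λ w → muS r w ≡ suc (suc k)) (m+[n∸m]≡n le) (stable (t ∸ suc k))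
  where
  stable : ∀ n → muS r (suc k + n) ≡ suc (suc k)
  stable zero rewrite +-identityʳ k | muS-before r k h k ≤-refl | e = refl
  stable (suc n) rewrite +-suc k n | stable n = refl

mutual
  sound : ∀ {n} (c : Code n) t xs v → run c t xs ≡ suc v → Eval c xs v
  sound zer t xs v refl = ev-zer
  sound succ t (x ∷ []) v refl = ev-succ
  sound (proj i) t xs v refl = ev-proj
  sound (comp f gs) t xs v e with guardAll-inv (runAll gs t xs) _ v e
  ... | zs , e1 , e2 = ev-comp (soundAll gs t xs zs e1)
          (sound f t zs v (trans (cong (run f t) (sym (trans (cong (map pred) e1) (pred-values zs)))) e2))
  sound (prec f g) t (k ∷ xs) v e = soundPrec f g t xs k v e
  sound (mu f) t xs v e with muS-found (λ i → run f t (i ∷ xs)) t v (fin-inv _ v e)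
  ... | e0 , h = ev-mu (sound f t (v ∷ xs) 0 e0) λ i p → proj₁ (h i p) , sound f t (i ∷ xs) _ (proj₂ (h i p))

  soundAll : ∀ {n m} (gs : Vec (Code n) m) t xs zs → runAll gs t xs ≡ map suc zs → EvalAll gs xs zs
  soundAll [] t xs [] e = ea-[]
  soundAll (g ∷ gs) t xs (z ∷ zs) e = ea-∷ (sound g t xs z (cong head e)) (soundAll gs t xs zs (cong tail e))

  soundPrec : ∀ {n} (f : Code n) g t xs k v →
    precS (run f t xs) (λ j a → run g t (j ∷ a ∷ xs)) k ≡ suc v → Eval (prec f g) (k ∷ xs) v
  soundPrec f g t xs zero v e = ev-prec0 (sound f t xs v e)
  soundPrec f g t xs (suc k) v e with precS (run f t xs) (λ j a → run g t (j ∷ a ∷ xs)) k in eq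
  ... | zero = ⊥-elim (0≢1+n e)
  ... | suc u = ev-precS (soundPrec f g t xs k u eq) (sound g t (k ∷ u ∷ xs) v e)

Eventually : (ℕ → Set) → Set
Eventually P = ∃ λ T → ∀ t → T ≤ t → P t

eventually-zip : ∀ {P Q R : ℕ → Set} → (∀ {t} → P t → Q t → R t) →
  Eventually P → Eventually Q → Eventually R
eventually-zip f (T₁ , h₁) (T₂ , h₂) =
  T₁ ⊔ T₂ , λ t le → f (h₁ t (≤-trans (m≤m⊔n T₁ T₂) le)) (h₂ t (≤-trans (m≤n⊔m T₁ T₂) le))

eventually-map : ∀ {P Q : ℕ → Set} → (∀ {t} → P t → Q t) → Eventually P → Eventually Q
eventually-map f (T , h) = T , λ t le → f (h t le)

eventually-≥ : ∀ n → Eventually (n ≤_)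
eventually-≥ n = n , λ t le → le

eventually-below : ∀ (P : ℕ → ℕ → Set) k → (∀ i → i < k → Eventually (P i)) →
  Eventually (λ t → ∀ i → i < k → P i t)
eventually-below P zero h = 0 , λ t _ i ()
eventually-below P (suc k) h =
  eventually-zip extend (eventually-below P k (λ i p → h i (m<n⇒m<1+n p))) (h k ≤-refl)
  where
  extend : ∀ {t} → (∀ i → i < k → P i t) → P k t → ∀ i → i < suc k → P i t
  extend below atK i p with m≤n⇒m<n∨m≡n (≤-pred p)
  ... | inj₁ lt = below i lt
  ... | inj₂ refl = atK

eventually-members : ∀ {A : Set} (P : A → ℕ → Set) (L : List A) → (∀ a → a ∈ L → Eventually (P a)) →
  Eventually (λ t → ∀ a → a ∈ L → P a t)
eventually-members P [] h = 0 , λ t _ a ()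
eventually-members P (a ∷ L) h =
  eventually-zip extend (h a (here refl)) (eventually-members P L (λ b m → h b (there m)))
  where
  extend : ∀ {t} → P a t → (∀ b → b ∈ L → P b t) → ∀ b → b ∈ a ∷ L → P b t
  extend atA rest b (here refl) = atA
  extend atA rest b (there m) = rest b m

mutual
  complete : ∀ {n} {c : Code n} {xs v} → Eval c xs v → Eventually (λ t → run c t xs ≡ suc v)
  complete ev-zer = 0 , λ t _ → refl
  complete ev-succ = 0 , λ t _ → refl
  complete ev-proj = 0 , λ t _ → refl
  complete (ev-comp {f = f} {gs = gs} {xs = xs} {ys = ys} {v = v} a e) =
    eventually-zip composed (completeAll a) (complete e)
    where
    composed : ∀ {t} → runAll gs t xs ≡ map suc ys → run f t ys ≡ suc v → run (comp f gs) t xs ≡ suc v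
    composed {t} args val = begin
      guardAll (runAll gs t xs) (run f t (map pred (runAll gs t xs)))
        ≡⟨ cong (λ w → guardAll w (run f t (map pred w))) args ⟩
      guardAll (map suc ys) (run f t (map pred (map suc ys)))
        ≡⟨ guardAll-values ys _ ⟩
      run f t (map pred (map suc ys))
        ≡⟨ cong (run f t) (pred-values ys) ⟩
      run f t ys
        ≡⟨ val ⟩
      suc v ∎
      where open ≡-Reasoning
  complete (ev-prec0 e) = complete e
  complete (ev-precS {g = g} {k = k} {xs = xs} e₁ e₂) =
    eventually-zip (λ {t} prev step → trans (cong (λ w → guard w (run g t (k ∷ pred w ∷ xs))) prev) step)
      (complete e₁) (complete e₂)
  complete (ev-mu {f = f} {xs = xs} {k = k} e₀ h) =
    eventually-zip (λ {t} (root , below) le → cong fin (muS-after (λ i → run f t (i ∷ xs)) k below root t le))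
      (eventually-zip _,_ (complete e₀) (eventually-below _ k valueBelow)) (eventually-≥ (suc k))
    where
    valueBelow : ∀ i → i < k → Eventually (λ t → ∃ λ u → run f t (i ∷ xs) ≡ suc (suc u))
    valueBelow i p = eventually-map (_ ,_) (complete (proj₂ (h i p)))

  completeAll : ∀ {n m} {gs : Vec (Code n) m} {xs ys} → EvalAll gs xs ys →
    Eventually (λ t → runAll gs t xs ≡ map suc ys)
  completeAll ea-[] = 0 , λ t _ → refl
  completeAll (ea-∷ e a) = eventually-zip (cong₂ _∷_) (complete e) (completeAll a)

mutual
  det : ∀ {n} {c : Code n} {xs v w} → Eval c xs v → Eval c xs w → v ≡ w
  det ev-zer ev-zer = refl
  det ev-succ ev-succ = refl
  det ev-proj ev-proj = refl
  det (ev-comp a₁ e₁) (ev-comp a₂ e₂) with detAll a₁ a₂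
  ... | refl = det e₁ e₂
  det (ev-prec0 e₁) (ev-prec0 e₂) = det e₁ e₂
  det (ev-precS e₁ g₁) (ev-precS e₂ g₂) with det e₁ e₂
  ... | refl = det g₁ g₂
  det (ev-mu {k = k} e₀ h) (ev-mu {k = k'} e₀' h') with <-cmp k k'
  ... | tri≈ _ eq _ = eq
  ... | tri< lt _ _ = ⊥-elim (0≢1+n (det e₀ (proj₂ (h' k lt))))
  ... | tri> _ _ gt = ⊥-elim (0≢1+n (det e₀' (proj₂ (h k' gt))))

  detAll : ∀ {n m} {gs : Vec (Code n) m} {xs ys zs} → EvalAll gs xs ys → EvalAll gs xs zs → ys ≡ zs
  detAll ea-[] ea-[] = refl
  detAll (ea-∷ e₁ a₁) (ea-∷ e₂ a₂) = cong₂ _∷_ (det e₁ e₂) (detAll a₁ a₂)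

GUARDS : ∀ m → Code (suc m)
GUARDS zero = proj zero
GUARDS (suc m) = app₃ IFZ (proj (suc zero)) zer (comp (GUARDS m) (proj zero ∷ drops 2 m))

c-GUARDS : ∀ m → Computes (GUARDS m) (λ v → guardAll (tail v) (head v))
c-GUARDS zero = computes-cong (c-proj zero) λ { (r ∷ []) → refl }
c-GUARDS (suc m) =
  computes-cong (c-app₃ c-IFZ (c-proj (suc zero)) c-zer (c-comp (c-GUARDS m) (ca-∷ (c-proj zero) (ca-drops 2 m))))
    λ { (r ∷ y ∷ ys) → refl }

MU-STEP : Code 3
MU-STEP = app₃ IFZ (proj (suc zero))
  (app₃ IFZ (proj (suc (suc zero))) ONE
    (app₃ IFZ (app₁ PRED (proj (suc (suc zero)))) (app₁ succ (app₁ succ (proj zero))) zer))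
  (proj (suc zero))

c-MU-STEP : Computes MU-STEP (fun₃ muStep)
c-MU-STEP = computes-cong
  (c-app₃ c-IFZ (c-proj (suc zero))
    (c-app₃ c-IFZ (c-proj (suc (suc zero))) c-ONE
      (c-app₃ c-IFZ (c-app₁ c-PRED (c-proj (suc (suc zero)))) (c-app₁ c-succ (c-app₁ c-succ (c-proj zero))) c-zer))
    (c-proj (suc zero)))
  λ { (i ∷ s ∷ r ∷ []) → refl }

FIN : Code 1
FIN = app₃ IFZ (proj zero) zer (app₃ IFZ (app₁ PRED (proj zero)) zer (app₁ PRED (proj zero)))

c-FIN : Computes FIN (fun₁ fin)
c-FIN = computes-cong
  (c-app₃ c-IFZ (c-proj zero) c-zer (c-app₃ c-IFZ (c-app₁ c-PRED (c-proj zero)) c-zer (c-app₁ c-PRED (c-proj zero))))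
  λ { (s ∷ []) → refl }

-- `runCode c` computes the clocked interpreter of c, with the fuel as its
-- first argument.  It only uses `prec`, never `mu`, so it is total.
mutual
  runCode : ∀ {n} → Code n → Code (suc n)
  runCode zer = ONE
  runCode succ = app₁ succ (app₁ succ (proj (suc zero)))
  runCode (proj i) = app₁ succ (proj (suc i))
  runCode (comp {m} f gs) = comp (GUARDS m) (comp (runCode f) (proj zero ∷ runPredAll gs) ∷ runCodeAll gs)
  runCode (prec {n} f g) =
    comp (prec (runCode f)
               (app₃ IFZ (proj (suc zero)) zer
                 (comp (runCode g) (proj (suc (suc zero)) ∷ proj zero ∷ app₁ PRED (proj (suc zero)) ∷ drops 3 n))))
         (proj (suc zero) ∷ proj zero ∷ drops 2 n)
  runCode (mu {n} f) =
    app₁ FIN (comp (prec zer (app₃ MU-STEP (proj zero) (proj (suc zero))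
                                (comp (runCode f) (proj (suc (suc zero)) ∷ proj zero ∷ drops 3 n))))
                   (proj zero ∷ proj zero ∷ drops 1 n))

  runCodeAll : ∀ {n m} → Vec (Code n) m → Vec (Code (suc n)) m
  runCodeAll [] = []
  runCodeAll (g ∷ gs) = runCode g ∷ runCodeAll gs

  runPredAll : ∀ {n m} → Vec (Code n) m → Vec (Code (suc n)) m
  runPredAll [] = []
  runPredAll (g ∷ gs) = app₁ PRED (runCode g) ∷ runPredAll gs

runWithFuel : ∀ {n} → Code n → Vec ℕ (suc n) → ℕ
runWithFuel c v = run c (head v) (tail v)

runCode-prec-unfold : ∀ {n} (bf : ℕ → Vec ℕ n → ℕ) (sg : ℕ → Vec ℕ (suc (suc n)) → ℕ) k t xs →
  primrec (λ v → bf (head v) (tail v))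
    (λ v → ifz (lookup v (suc zero)) 0
             (sg (lookup v (suc (suc zero))) (lookup v zero ∷ pred (lookup v (suc zero)) ∷ dropV 3 v)))
    (k ∷ t ∷ xs) ≡ precS (bf t xs) (λ j a → sg t (j ∷ a ∷ xs)) k
runCode-prec-unfold bf sg zero t xs = refl
runCode-prec-unfold bf sg (suc k) t xs rewrite runCode-prec-unfold bf sg k t xs = refl

runCode-mu-unfold : ∀ {n} (sf : ℕ → Vec ℕ (suc n) → ℕ) c t xs →
  primrec (λ _ → 0)
    (λ v → muStep (lookup v zero) (lookup v (suc zero)) (sf (lookup v (suc (suc zero))) (lookup v zero ∷ dropV 3 v)))
    (c ∷ t ∷ xs) ≡ muS (λ i → sf t (i ∷ xs)) c
runCode-mu-unfold sf zero t xs = refl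
runCode-mu-unfold sf (suc c) t xs rewrite runCode-mu-unfold sf c t xs = refl

mutual
  c-runCode : ∀ {n} (c : Code n) → Computes (runCode c) (runWithFuel c)
  c-runCode zer = computes-cong c-ONE λ { (t ∷ xs) → refl }
  c-runCode succ = computes-cong (c-app₁ c-succ (c-app₁ c-succ (c-proj (suc zero)))) λ { (t ∷ x ∷ []) → refl }
  c-runCode (proj i) = computes-cong (c-app₁ c-succ (c-proj (suc i))) λ { (t ∷ xs) → refl }
  c-runCode (comp {m} f gs) =
    computes-cong (c-comp (c-GUARDS m) (ca-∷ (c-comp (c-runCode f) (ca-∷ (c-proj zero) (c-runPredAll gs))) (c-runCodeAll gs)))
      λ { (t ∷ xs) → refl }
  c-runCode (prec {n} f g) =
    computes-cong
      (c-comp (c-prec (c-runCode f)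
                      (c-app₃ c-IFZ (c-proj (suc zero)) c-zer
                        (c-comp (c-runCode g)
                          (ca-∷ (c-proj (suc (suc zero))) (ca-∷ (c-proj zero)
                            (ca-∷ (c-app₁ c-PRED (c-proj (suc zero))) (ca-drops 3 n)))))))
              (ca-∷ (c-proj (suc zero)) (ca-∷ (c-proj zero) (ca-drops 2 n))))
      λ { (t ∷ k ∷ xs) → runCode-prec-unfold (run f) (run g) k t xs }
  c-runCode (mu {n} f) =
    computes-cong
      (c-app₁ c-FIN
        (c-comp (c-prec c-zer (c-app₃ c-MU-STEP (c-proj zero) (c-proj (suc zero))
                                (c-comp (c-runCode f) (ca-∷ (c-proj (suc (suc zero))) (ca-∷ (c-proj zero) (ca-drops 3 n))))))
                (ca-∷ (c-proj zero) (ca-∷ (c-proj zero) (ca-drops 1 n)))))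
      λ { (t ∷ xs) → cong fin (runCode-mu-unfold (run f) t t xs) }

  c-runCodeAll : ∀ {n m} (gs : Vec (Code n) m) →
    ComputesAll (runCodeAll gs) (λ v → runAll gs (head v) (tail v))
  c-runCodeAll [] = computesAll-cong ca-[] λ { (t ∷ xs) → refl }
  c-runCodeAll (g ∷ gs) = computesAll-cong (ca-∷ (c-runCode g) (c-runCodeAll gs)) λ { (t ∷ xs) → refl }

  c-runPredAll : ∀ {n m} (gs : Vec (Code n) m) →
    ComputesAll (runPredAll gs) (λ v → map pred (runAll gs (head v) (tail v)))
  c-runPredAll [] = computesAll-cong ca-[] λ { (t ∷ xs) → refl }
  c-runPredAll (g ∷ gs) = computesAll-cong (ca-∷ (c-app₁ c-PRED (c-runCode g)) (c-runPredAll gs)) λ { (t ∷ xs) → refl }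

c-runCode₁ : (c : Code 1) → Computes (runCode c) (fun₂ (λ t x → run c t (x ∷ [])))
c-runCode₁ c = computes-cong (c-runCode c) λ { (t ∷ x ∷ []) → refl }

-- Inverting the Cantor pairing `pair a b = tri (a + b) + b`.  `diag m` is
-- the diagonal of m, the largest s with tri s ≤ m, computed by counting.
leb : ℕ → ℕ → ℕ
leb x y = ifz (x ∸ y) 1 0

diag : ℕ → ℕ
diag zero = 0
diag (suc m) = diag m + leb (tri (suc (diag m))) (suc m)

DIAG : Code 1
DIAG = prec zer (app₂ ADD (proj (suc zero))
                  (app₃ IFZ (app₂ SUB (app₁ TRI (app₁ succ (proj (suc zero)))) (app₁ succ (proj zero))) ONE zer))

c-DIAG : Computes DIAG (fun₁ diag)
c-DIAG = computes-cong
  (c-prec c-zer (c-app₂ c-ADD (c-proj (suc zero))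
    (c-app₃ c-IFZ (c-app₂ c-SUB (c-app₁ c-TRI (c-app₁ c-succ (c-proj (suc zero)))) (c-app₁ c-succ (c-proj zero))) c-ONE c-zer)))
  counting
  where
  counting : ∀ xs → primrec _ _ xs ≡ fun₁ diag xs
  counting (zero ∷ []) = refl
  counting (suc m ∷ []) = cong (λ s → s + leb (tri (suc s)) (suc m)) (counting (m ∷ []))

diag-bounds : ∀ m → tri (diag m) ≤ m × m < tri (suc (diag m))
diag-bounds zero = z≤n , s≤s z≤n
diag-bounds (suc m) with diag-bounds m
... | lo , hi with tri (suc (diag m)) ∸ suc m in eq
... | zero = subst (λ w → tri w ≤ suc m) (sym (+-comm (diag m) 1)) (m∸n≡0⇒m≤n eq) ,
             subst (λ w → suc m < tri (suc w)) (sym (+-comm (diag m) 1))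
               (≤-trans (s≤s hi) (s≤s (m≤n+m _ (suc (diag m)))))
... | suc d = subst (λ w → tri w ≤ suc m) (sym (+-identityʳ (diag m))) (≤-trans lo (n≤1+n m)) ,
              subst (λ w → suc m < tri (suc w)) (sym (+-identityʳ (diag m)))
                (≰⇒> (λ le → 1+n≢0 (trans (sym eq) (m≤n⇒m∸n≡0 le))))

tri-mono : ∀ a b → a < b → tri (suc a) ≤ tri b
tri-mono a (suc b) (s≤s le) with m≤n⇒m<n∨m≡n le
... | inj₂ refl = ≤-refl
... | inj₁ lt = ≤-trans (tri-mono a b lt) (m≤n+m (tri b) (suc b))

diag-pair : ∀ a b → diag (pair a b) ≡ a + b
diag-pair a b with diag-bounds (pair a b) | <-cmp (diag (pair a b)) (a + b)
... | lo , hi | tri≈ _ e _ = e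
... | lo , hi | tri< lt _ _ = ⊥-elim (<⇒≱ hi (≤-trans (tri-mono _ _ lt) (m≤m+n (tri (a + b)) b)))
... | lo , hi | tri> _ _ gt = ⊥-elim (<⇒≱ (≤-trans belowNext (tri-mono _ _ gt)) lo)
  where
  belowNext : pair a b < tri (suc (a + b))
  belowNext = subst (λ w → w < tri (suc (a + b))) (+-comm b (tri (a + b)))
                (+-monoˡ-< (tri (a + b)) (s≤s (m≤n+m b a)))

unpair₂ : ℕ → ℕ
unpair₂ m = m ∸ tri (diag m)

unpair₁ : ℕ → ℕ
unpair₁ m = diag m ∸ unpair₂ m

unpair₂-pair : ∀ a b → unpair₂ (pair a b) ≡ b
unpair₂-pair a b rewrite diag-pair a b = m+n∸m≡n (tri (a + b)) b

unpair₁-pair : ∀ a b → unpair₁ (pair a b) ≡ a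
unpair₁-pair a b rewrite unpair₂-pair a b | diag-pair a b = m+n∸n≡m a b

UNPAIR₂ : Code 1
UNPAIR₂ = app₂ SUB (proj zero) (app₁ TRI (app₁ DIAG (proj zero)))

c-UNPAIR₂ : Computes UNPAIR₂ (fun₁ unpair₂)
c-UNPAIR₂ = computes-cong (c-app₂ c-SUB (c-proj zero) (c-app₁ c-TRI (c-app₁ c-DIAG (c-proj zero)))) λ { (m ∷ []) → refl }

UNPAIR₁ : Code 1
UNPAIR₁ = app₂ SUB (app₁ DIAG (proj zero)) (app₁ UNPAIR₂ (proj zero))

c-UNPAIR₁ : Computes UNPAIR₁ (fun₁ unpair₁)
c-UNPAIR₁ = computes-cong (c-app₂ c-SUB (c-app₁ c-DIAG (c-proj zero)) (c-app₁ c-UNPAIR₂ (c-proj zero))) λ { (m ∷ []) → refl }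

hd : ℕ → ℕ
hd l = unpair₁ (pred l)

tl : ℕ → ℕ
tl l = unpair₂ (pred l)

hd-encList : ∀ x xs → hd (encList (x ∷ xs)) ≡ enc x
hd-encList x xs = unpair₁-pair (enc x) (encList xs)

tl-encList : ∀ x xs → tl (encList (x ∷ xs)) ≡ encList xs
tl-encList x xs = unpair₂-pair (enc x) (encList xs)

HD : Code 1
HD = app₁ UNPAIR₁ (app₁ PRED (proj zero))

c-HD : Computes HD (fun₁ hd)
c-HD = computes-cong (c-app₁ c-UNPAIR₁ (c-app₁ c-PRED (c-proj zero))) λ { (m ∷ []) → refl }

TL : Code 1
TL = app₁ UNPAIR₂ (app₁ PRED (proj zero))

c-TL : Computes TL (fun₁ tl)
c-TL = computes-cong (c-app₁ c-UNPAIR₂ (c-app₁ c-PRED (c-proj zero))) λ { (m ∷ []) → refl }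

tails : ℕ → ℕ → ℕ
tails zero l = l
tails (suc i) l = tl (tails i l)

TAILS : Code 2
TAILS = prec (proj zero) (app₁ TL (proj (suc zero)))

c-TAILS : Computes TAILS (fun₂ tails)
c-TAILS = computes-cong (c-prec (c-proj zero) (c-app₁ c-TL (c-proj (suc zero)))) iterate
  where
  iterate : ∀ xs → primrec _ _ xs ≡ fun₂ tails xs
  iterate (zero ∷ l ∷ []) = refl
  iterate (suc i ∷ l ∷ []) = cong tl (iterate (i ∷ l ∷ []))

tails-suc : ∀ i l → tails (suc i) l ≡ tails i (tl l)
tails-suc zero l = refl
tails-suc (suc i) l = cong tl (tails-suc i l)

tails-empty : ∀ i → tails i 0 ≡ 0
tails-empty zero = refl
tails-empty (suc i) rewrite tails-empty i = refl

atHead : (ℕ → ℕ) → ℕ → ℕ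
atHead h l = ifz l 0 (h (hd l))

-- Sum of `atHead h` over the first N tails of l, in the order in which a
-- primitive recursion on N accumulates it.
sumTails : (ℕ → ℕ) → ℕ → ℕ → ℕ
sumTails h zero l = 0
sumTails h (suc i) l = sumTails h i l + atHead h (tails i l)

sumTails-cons : ∀ h N l → sumTails h (suc N) l ≡ atHead h l + sumTails h N (tl l)
sumTails-cons h zero l = +-comm 0 (atHead h l)
sumTails-cons h (suc N) l rewrite sumTails-cons h N l | tails-suc N l = +-assoc (atHead h l) _ _

-- Sum of h over a coded list; the code l bounds its length.
sumOver : (ℕ → ℕ) → ℕ → ℕ
sumOver h l = sumTails h l l

sumCodes : (ℕ → ℕ) → List (List Bool) → ℕ
sumCodes h [] = 0
sumCodes h (x ∷ L) = h (enc x) + sumCodes h L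

sumTails-encList : ∀ h L N → length L ≤ N → sumTails h N (encList L) ≡ sumCodes h L
sumTails-encList h [] zero le = refl
sumTails-encList h [] (suc N) le rewrite tails-empty N = trans (+-identityʳ _) (sumTails-encList h [] N z≤n)
sumTails-encList h (x ∷ L) (suc N) (s≤s le) = begin
  sumTails h (suc N) (encList (x ∷ L))                          ≡⟨ sumTails-cons h N (encList (x ∷ L)) ⟩
  h (hd (encList (x ∷ L))) + sumTails h N (tl (encList (x ∷ L))) ≡⟨ cong₂ _+_ (cong h (hd-encList x L))
                                                                       (cong (sumTails h N) (tl-encList x L)) ⟩
  h (enc x) + sumTails h N (encList L)                            ≡⟨ cong (h (enc x) +_) (sumTails-encList h L N le) ⟩
  sumCodes h (x ∷ L)                                              ∎
  where open ≡-Reasoning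

length≤encList : ∀ L → length L ≤ encList L
length≤encList [] = z≤n
length≤encList (x ∷ L) = s≤s (≤-trans (length≤encList L) (m≤n+m (encList L) (tri (enc x + encList L))))

sumOver-encList : ∀ h L → sumOver h (encList L) ≡ sumCodes h L
sumOver-encList h L = sumTails-encList h L (encList L) (length≤encList L)

sumCodes-zero : ∀ h L → sumCodes h L ≡ 0 → ∀ x → x ∈ L → h (enc x) ≡ 0
sumCodes-zero h (y ∷ L) e x (here refl) = m+n≡0⇒m≡0 _ e
sumCodes-zero h (y ∷ L) e x (there p) = sumCodes-zero h L (m+n≡0⇒n≡0 (h (enc y)) e) x p

sumCodes-all-zero : ∀ h L → (∀ x → x ∈ L → h (enc x) ≡ 0) → sumCodes h L ≡ 0
sumCodes-all-zero h [] H = refl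
sumCodes-all-zero h (y ∷ L) H rewrite H y (here refl) = sumCodes-all-zero h L (λ x p → H x (there p))

sumCodes-nonzero : ∀ h L x → x ∈ L → ¬ h (enc x) ≡ 0 → ¬ sumCodes h L ≡ 0
sumCodes-nonzero h L x m nz e = nz (sumCodes-zero h L e x m)

ifz-nonzero : ∀ {n} → ¬ n ≡ 0 → ifz n 0 1 ≡ 1
ifz-nonzero {zero} nz = ⊥-elim (nz refl)
ifz-nonzero {suc n} nz = refl

SUM-OVER : ∀ {n} → Code (suc n) → Fin n → Code n
SUM-OVER {n} B ix = comp (prec zer (app₂ ADD (proj (suc zero)) summand)) (proj ix ∷ drops 0 n)
  where
  tailCode : Code (suc (suc n))
  tailCode = app₂ TAILS (proj zero) (proj (suc (suc ix)))
  summand : Code (suc (suc n))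
  summand = app₃ IFZ tailCode zer (comp B (app₁ HD tailCode ∷ drops 2 n))

c-SUM-OVER : ∀ {n} {B : Code (suc n)} {F} (ix : Fin n) → Computes B F →
  Computes (SUM-OVER B ix) (λ xs → sumOver (λ y → F (y ∷ xs)) (lookup xs ix))
c-SUM-OVER {n} {B} {F} ix hB = computes-cong
  (c-comp (c-prec c-zer (c-app₂ c-ADD (c-proj (suc zero)) (c-app₃ c-IFZ cTail c-zer
            (c-comp hB (ca-∷ (c-app₁ c-HD cTail) (ca-drops 2 n))))))
          (ca-∷ (c-proj ix) (ca-drops 0 n)))
  λ xs → accumulate (lookup xs ix) xs
  where
  cTail : Computes (app₂ TAILS (proj zero) (proj (suc (suc ix))))
                   (λ v → tails (lookup v zero) (lookup v (suc (suc ix))))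
  cTail = c-app₂ c-TAILS (c-proj zero) (c-proj (suc (suc ix)))
  accumulate : ∀ N xs → primrec _ _ (N ∷ xs) ≡ sumTails (λ y → F (y ∷ xs)) N (lookup xs ix)
  accumulate zero xs = refl
  accumulate (suc N) xs = cong (_+ atHead (λ y → F (y ∷ xs)) (tails N (lookup xs ix))) (accumulate N xs)

least-root : (g : ℕ → ℕ) (T : ℕ) → g T ≡ 0 → ∃ λ k → g k ≡ 0 × (∀ i → i < k → ∃ λ u → g i ≡ suc u)
least-root g zero e = 0 , e , λ i ()
least-root g (suc T) e with g 0 in e0
... | zero = 0 , e0 , λ i ()
... | suc u0 with least-root (λ i → g (suc i)) T e
...   | k , ek , hk = suc k , ek , λ { zero _ → u0 , e0 ; (suc i) (s≤s p) → hk i p }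

mu-defined : ∀ {n} {f : Code (suc n)} {F} → Computes f F → ∀ xs T → F (T ∷ xs) ≡ 0 →
  ∃ λ k → Eval (mu f) xs k × F (k ∷ xs) ≡ 0
mu-defined {f = f} {F} hf xs T e with least-root (λ i → F (i ∷ xs)) T e
... | k , root , below =
  k , ev-mu (subst (Eval f _) root (hf _)) (λ i p → proj₁ (below i p) , subst (Eval f _) (proj₂ (below i p)) (hf _)) , root

mu-root : ∀ {n} {f : Code (suc n)} {F} → Computes f F → ∀ {xs k} → Eval (mu f) xs k → F (k ∷ xs) ≡ 0
mu-root hf (ev-mu e₀ _) = det (hf _) e₀

pending : ℕ → ℕ
pending a = ifz a 1 0

pending-zero : ∀ a → pending a ≡ 0 → ∃ λ w → a ≡ suc w
pending-zero zero ()
pending-zero (suc w) _ = w , refl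

-- The computer C' of the proof: it maps x to the least fuel with which the
-- interpreter finds a value of C on x.  It has the domain of C.
module HaltingTime (C : Code 1) where

  HALTED? : Code 2
  HALTED? = app₃ IFZ (runCode C) ONE zer

  c-HALTED? : Computes HALTED? (fun₂ (λ t x → pending (run C t (x ∷ []))))
  c-HALTED? = computes-cong (c-app₃ c-IFZ (c-runCode₁ C) c-ONE c-zer) λ { (t ∷ x ∷ []) → refl }

  haltingTime : Code 1
  haltingTime = mu HALTED?

  haltingTime-halts : ∀ {x s} → Eval haltingTime (x ∷ []) s → ∃ λ w → run C s (x ∷ []) ≡ suc w
  haltingTime-halts e = pending-zero _ (mu-root c-HALTED? e)

  haltingTime-sound : ∀ {x s} → Eval haltingTime (x ∷ []) s → ∃ λ v → Eval C (x ∷ []) v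
  haltingTime-sound {x} {s} e = let (w , eq) = haltingTime-halts e in w , sound C s (x ∷ []) w eq

  haltingTime-defined : ∀ {x v} → Eval C (x ∷ []) v → ∃ λ s → Eval haltingTime (x ∷ []) s
  haltingTime-defined {x} e =
    let (T , H) = complete e
        (s , eH , _) = mu-defined c-HALTED? (x ∷ []) T (cong pending (H T ≤-refl))
    in s , eH

  haltingTime-computer : IsComputer C → IsComputer haltingTime
  haltingTime-computer isC p q (_ , e) (_ , e') p≼q = isC p q (haltingTime-sound e) (haltingTime-sound e') p≼q

open HaltingTime using (haltingTime; haltingTime-computer)

module Decider (V C : Code 1) where
  open HaltingTime C using (haltingTime-halts; haltingTime-defined)

  -- V's answer with fuel t on y, for summands with arguments (y, t, x, l).
  RUN-V : Code 4
  RUN-V = app₂ (runCode V) (proj (suc zero)) (proj zero)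

  c-RUN-V : Computes RUN-V (λ v → run V (lookup v (suc zero)) (lookup v zero ∷ []))
  c-RUN-V = c-app₂ (c-runCode₁ V) (c-proj (suc zero)) (c-proj zero)

  unsettled : ℕ → ℕ → ℕ
  unsettled t y = pending (run V t (y ∷ []))

  witness : ℕ → ℕ → ℕ → ℕ
  witness k x y = ifz (run V k (y ∷ [])) 0 (run C (pred (run V k (y ∷ []))) (x ∷ []))

  UNSETTLED : Code 3
  UNSETTLED = SUM-OVER (app₃ IFZ RUN-V ONE zer) (suc (suc zero))

  c-UNSETTLED : Computes UNSETTLED (fun₃ (λ t x l → sumOver (unsettled t) l))
  c-UNSETTLED = computes-cong (c-SUM-OVER (suc (suc zero)) (c-app₃ c-IFZ c-RUN-V c-ONE c-zer))
    λ { (t ∷ x ∷ l ∷ []) → refl }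

  WITNESSES : Code 3
  WITNESSES = SUM-OVER (app₃ IFZ RUN-V zer (app₂ (runCode C) (app₁ PRED RUN-V) (proj (suc (suc zero)))))
                       (suc (suc zero))

  c-WITNESSES : Computes WITNESSES (fun₃ (λ k x l → sumOver (witness k x) l))
  c-WITNESSES = computes-cong
    (c-SUM-OVER (suc (suc zero))
      (c-app₃ c-IFZ c-RUN-V c-zer (c-app₂ (c-runCode₁ C) (c-app₁ c-PRED c-RUN-V) (c-proj (suc (suc zero))))))
    λ { (k ∷ x ∷ l ∷ []) → refl }

  -- On (x, l): search a fuel k with which V has a value on every member of
  -- l, then answer 1 iff some member is a witness.
  DECIDER : Code 2
  DECIDER = comp (app₃ IFZ WITNESSES zer ONE) (mu UNSETTLED ∷ proj zero ∷ proj (suc zero) ∷ [])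

  decider-eval : ∀ {x L k} → Eval (mu UNSETTLED) (x ∷ encList L ∷ []) k →
    Eval DECIDER (x ∷ encList L ∷ []) (ifz (sumCodes (witness k x) L) 0 1)
  decider-eval {x} {L} {k} search =
    subst (Eval DECIDER _) (cong (λ w → ifz w 0 1) (sumOver-encList (witness k x) L))
      (ev-comp (ea-∷ search (ea-∷ ev-proj (ea-∷ ev-proj ea-[])))
               (c-app₃ c-IFZ c-WITNESSES c-zer c-ONE (k ∷ x ∷ encList L ∷ [])))

  settled-eventually : ∀ L → (∀ q → q ∈ L → Dom V q) → Eventually (λ t → sumCodes (unsettled t) L ≡ 0)
  settled-eventually L inDom =
    eventually-map (λ halted → sumCodes-all-zero _ L (λ q m → cong pending (proj₂ (halted q m))))
      (eventually-members (λ q t → ∃ λ u → run V t (enc q ∷ []) ≡ suc u) L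
        (λ q m → eventually-map (_ ,_) (complete (proj₂ (inDom q m)))))

  settled-members : ∀ k L → sumCodes (unsettled k) L ≡ 0 → ∀ q → q ∈ L → ∃ λ u → run V k (enc q ∷ []) ≡ suc u
  settled-members k L none q m = pending-zero _ (sumCodes-zero (unsettled k) L none q m)

  settles : ∀ x L → (∀ q → q ∈ L → Dom V q) →
    ∃ λ k → Eval (mu UNSETTLED) (x ∷ encList L ∷ []) k × (∀ q → q ∈ L → ∃ λ u → run V k (enc q ∷ []) ≡ suc u)
  settles x L inDom with settled-eventually L inDom
  ... | T , H with mu-defined c-UNSETTLED (x ∷ encList L ∷ []) T (trans (sumOver-encList (unsettled T) L) (H T ≤-refl))
  ... | k , search , root = k , search , settled-members k L (trans (sym (sumOver-encList (unsettled k) L)) root)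

  witness-found : ∀ k x y s → run V k (y ∷ []) ≡ suc s → (∃ λ w → run C s (x ∷ []) ≡ suc w) → ¬ witness k x y ≡ 0
  witness-found k x y s eV (w , eC) rewrite eV = λ e → 1+n≢0 (trans (sym eC) e)

  no-witness : ∀ k x y → ¬ (∃ λ v → Eval C (x ∷ []) v) → witness k x y ≡ 0
  no-witness k x y undefined with run V k (y ∷ [])
  ... | zero = refl
  ... | suc s with run C s (x ∷ []) in eC
  ...   | zero = refl
  ...   | suc w = ⊥-elim (undefined (w , sound C s (x ∷ []) w eC))

  -- Correctness for every p, given d as in optimality of V for haltingTime C:
  -- a short V-program q ∈ L for the halting time of C on p is a witness.
  decides : ∀ d → (∀ p s → Eval (haltingTime C) (enc p ∷ []) s →
                     ∃ λ q → Eval V (enc q ∷ []) s × length q ≤ length p + d) →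
    ∀ p L → (∀ q → (q ∈ L) ⇔ (Dom V q × length q ≤ length p + d)) →
    (Dom C p → Eval DECIDER (enc p ∷ encList L ∷ []) 1) ×
    (¬ Dom C p → Eval DECIDER (enc p ∷ encList L ∷ []) 0)
  decides d short p L members with settles (enc p) L (λ q m → proj₁ (Equivalence.to (members q) m))
  ... | k , search , settled = accept , reject
    where
    accept : Dom C p → Eval DECIDER (enc p ∷ encList L ∷ []) 1
    accept (_ , eC) with haltingTime-defined eC
    ... | s , eH with short p s eH
    ... | q , eV , len with Equivalence.from (members q) ((s , eV) , len)
    ... | q∈L with settled q q∈L
    ... | u , eVk with det eV (sound V k (enc q ∷ []) u eVk)
    ... | refl = subst (Eval DECIDER _) (ifz-nonzero (sumCodes-nonzero (witness k (enc p)) L q q∈L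
                   (witness-found k (enc p) (enc q) s eVk (haltingTime-halts eH)))) (decider-eval search)

    reject : ¬ Dom C p → Eval DECIDER (enc p ∷ encList L ∷ []) 0
    reject undefined = subst (Eval DECIDER _)
      (cong (λ w → ifz w 0 1) (sumCodes-all-zero _ L (λ q _ → no-witness k (enc p) (enc q) undefined)))
      (decider-eval search)

open Decider using (DECIDER; decides)

-- Optimality of V applied to the computer `haltingTime C` supplies d; the
-- decider does not need L to be duplicate-free.

theorem3p6 : (V : Code 1) → IsOptimal V →
    (C : Code 1) → IsComputer C →
    ∃ λ (d : ℕ) → ∃ λ (D : Code 2) →
      ∀ (p : List Bool) (L : List (List Bool)) → Unique L →
        (∀ q → (q ∈ L) ⇔ (Dom V q × length q ≤ length p + d)) →
        (Dom C p → Eval D (enc p ∷ encList L ∷ []) 1) ×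
        (¬ Dom C p → Eval D (enc p ∷ encList L ∷ []) 0)
theorem3p6 V (_ , optimal) C isComputer =
  let (d , short) = optimal (haltingTime C) (haltingTime-computer C isComputer)
  in d , DECIDER V C , λ p L _ → decides V C d short p L
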